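{- Let $G_n$ be the graph defined below and $t\geq1$ an integer. Then $\mathbf{bp}_t(G_n^t)\leq t\,\mathbf{bp}(G_n)$.
   Context: Let $Q_k=\{0,1\}^k$, $0^k$, $1^k$ the all-zero and all-one vectors, $Q_k^-=Q_k\setminus\{0^k,1^k\}$, and $X\times Y$ the set of concatenations. Let $S = Q_7 \setminus \big[(1^4\times Q_3^-) \cup \{0^4\times 0^3\}\cup\{0^4\times 1^3\}\big]$. $G_n$ has vertex set $[n]^7$, and $x,y$ are adjacent iff $\rho(x,y)\in S$, where $\rho_i(x,y)=1$ if $x_i\neq y_i$ and $0$ otherwise. The OR product of graphs $G$ and $H$ has vertex set $V(G)\times V(H)$, with $(g,h)\sim(g',h')$ iff $g\sim g'$ in $G$ or $h\sim h'$ in $H$; $G^t$ denotes the OR product of $t$ copies of $G$. $\mathbf{bp}(G)$ is the minimum number of bicliques (complete bipartite subgraphs) partitioning the edges of $G$. $\mathbf{bp}_t(G)$ is the minimum size of a $t$-biclique covering of $G$, i.e. a collection of bicliques in $G$ such that every edge of $G$ lies in at least one and at most $t$ of them. -}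

module Defs where

open import Data.Nat using (ℕ; _≤_; _*_)
open import Data.Bool using (Bool; true; false; _∧_; _∨_; not; T)
open import Data.Bool.Properties using () renaming (_≟_ to _≟ᵇ_)
open import Data.Fin using (Fin; _≟_)
open import Data.Vec using (Vec; []; _∷_; zipWith; lookup)
open import Data.List using (List; length; filter)
open import Data.Product using (Σ; ∃; _×_)
open import Relation.Nullary.Decidable using (⌊_⌋)
open import Relation.Binary.PropositionalEquality using (_≡_)

record Graph : Set₁ where
  field
    V   : Set
    Adj : V → V → Set
open Graph public

-- Bicliques of G: two vertex sets (Boolean predicates) such that every
-- vertex of the first is adjacent in G to every vertex of the second.
-- (Hence the complete bipartite graph between them is a subgraph of G.)

record Biclique (G : Graph) : Set where
  field
    A B      : V G → Bool
    complete : ∀ a b → T (A a) → T (B b) → Adj G a b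
open Biclique public

edgeIn : {G : Graph} → Biclique G → V G → V G → Bool
edgeIn β x y = (A β x ∧ B β y) ∨ (A β y ∧ B β x)

mult : {G : Graph} → List (Biclique G) → V G → V G → ℕ
mult C x y = length (filter (λ β → edgeIn β x y ≟ᵇ true) C)

IsBicliquePartition : (G : Graph) → List (Biclique G) → Set
IsBicliquePartition G C = ∀ x y → Adj G x y → mult C x y ≡ 1

IsTBicliqueCovering : ℕ → (G : Graph) → List (Biclique G) → Set
IsTBicliqueCovering t G C = ∀ x y → Adj G x y → (1 ≤ mult C x y) × (mult C x y ≤ t)

-- OR product power G^t : vertices are t-tuples, adjacent iff adjacent
-- in G in at least one coordinate.

ORPower : Graph → ℕ → Graph
ORPower G t = record
  { V   = Vec (V G) t
  ; Adj = λ x y → ∃ λ (i : Fin t) → Adj G (lookup x i) (lookup y i) }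

allOne : ∀ {k} → Vec Bool k → Bool
allOne []       = true
allOne (b ∷ bs) = b ∧ allOne bs

allZero : ∀ {k} → Vec Bool k → Bool
allZero []       = true
allZero (b ∷ bs) = not b ∧ allZero bs

inQ⁻ : ∀ {k} → Vec Bool k → Bool
inQ⁻ v = not (allZero v) ∧ not (allOne v)

inS : Vec Bool 7 → Bool
inS (a ∷ b ∷ c ∷ d ∷ q) =
  not ((allOne p ∧ inQ⁻ q) ∨ (allZero p ∧ allZero q) ∨ (allZero p ∧ allOne q))
  where p = a ∷ b ∷ c ∷ d ∷ []

ρ : ∀ {n k} → Vec (Fin n) k → Vec (Fin n) k → Vec Bool k
ρ = zipWith (λ a b → not ⌊ a ≟ b ⌋)

Gn : ℕ → Graph
Gn n = record
  { V   = Vec (Fin n) 7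
  ; Adj = λ x y → T (inS (ρ x y)) }

-- Pull a biclique partition P of G back along each of the t coordinate projections of
-- G^t. An edge x ∼ y of G^t is adjacent in some coordinate i, so it is covered by the
-- copy of P on coordinate i; and since G is symmetric, each pair (x_i, y_i) lies in at
-- most one biclique of P, so x ∼ y is covered at most t times. This uses t·|P| bicliques.
module Submission where

open import Defs
open import Data.Nat using (ℕ; _≤_; _*_)
open import Data.List using (List; length)
open import Data.Product using (Σ; _×_)

open import Data.Bool using (true; false; not; T)
open import Data.Bool.Properties using (T-∧; T-∨) renaming (_≟_ to _≟ᵇ_)
open import Data.Fin using (Fin; _≟_)
open import Data.List using ([]; _∷_; _++_; map; concatMap; filter; allFin)
open import Data.List.Properties using (length-++; length-map; filter-++; length-tabulate)
open import Data.List.Membership.Propositional using (_∈_)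
open import Data.List.Membership.Propositional.Properties using (∈-allFin)
open import Data.List.Relation.Unary.Any using (here; there)
open import Data.Nat using (suc; _+_; z≤n)
open import Data.Nat.Properties using (≤-reflexive; ≤-trans; +-mono-≤; m≤m+n; m≤n+m)
open import Data.Product using (_,_; ∃)
open import Data.Sum using (_⊎_; inj₁; inj₂)
open import Data.Vec using (Vec; lookup)
open import Data.Vec.Properties using (zipWith-comm)
open import Function.Base using (id)
open import Function.Bundles using (Equivalence; mk⇔)
open import Relation.Nullary using (does)
open import Relation.Nullary.Decidable using (⌊_⌋; isYes≗does; does-⇔)
open import Relation.Binary.PropositionalEquality using (_≡_; refl; sym; trans; cong; cong₂; subst; module ≡-Reasoning)

open Equivalence using (to)

module _ {G : Graph} where

  mult-++ : ∀ (C D : List (Biclique G)) x y → mult (C ++ D) x y ≡ mult C x y + mult D x y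
  mult-++ C D x y = trans (cong length (filter-++ covers? C D)) (length-++ (filter covers? C))
    where covers? = λ (β : Biclique G) → edgeIn β x y ≟ᵇ true

  edgeIn⇒Adj : ∀ (β : Biclique G) x y → T (edgeIn β x y) → Adj G x y ⊎ Adj G y x
  edgeIn⇒Adj β x y e with to T-∨ e
  ... | inj₁ ab = let (a , b) = to T-∧ ab in inj₁ (complete β x y a b)
  ... | inj₂ ab = let (a , b) = to T-∧ ab in inj₂ (complete β y x a b)

  mult≡0⊎edgeIn : ∀ (C : List (Biclique G)) x y →
                  mult C x y ≡ 0 ⊎ ∃ λ (β : Biclique G) → T (edgeIn β x y)
  mult≡0⊎edgeIn []      x y = inj₁ refl
  mult≡0⊎edgeIn (β ∷ C) x y with edgeIn β x y in e
  ... | true  = inj₂ (β , subst T (sym e) _)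
  ... | false = mult≡0⊎edgeIn C x y

  partition⇒mult≤1 : (∀ x y → Adj G x y → Adj G y x) → ∀ {P} → IsBicliquePartition G P →
                     ∀ x y → mult P x y ≤ 1
  partition⇒mult≤1 adj-sym {P} partition x y with mult≡0⊎edgeIn P x y
  ... | inj₁ mult≡0 = ≤-trans (≤-reflexive mult≡0) z≤n
  ... | inj₂ (β , e) with edgeIn⇒Adj β x y e
  ... | inj₁ x∼y = ≤-reflexive (partition x y x∼y)
  ... | inj₂ y∼x = ≤-reflexive (partition x y (adj-sym y x y∼x))

module _ {G : Graph} {t : ℕ} where

  onCoordinate : Fin t → Biclique G → Biclique (ORPower G t)
  onCoordinate i β = record
    { A        = λ x → A β (lookup x i)
    ; B        = λ x → B β (lookup x i)
    ; complete = λ a b a∈A b∈B → i , complete β (lookup a i) (lookup b i) a∈A b∈B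
    }

  mult-onCoordinate : ∀ i (P : List (Biclique G)) x y →
                      mult (map (onCoordinate i) P) x y ≡ mult P (lookup x i) (lookup y i)
  mult-onCoordinate i []      x y = refl
  mult-onCoordinate i (β ∷ P) x y with edgeIn β (lookup x i) (lookup y i)
  ... | true  = cong suc (mult-onCoordinate i P x y)
  ... | false = mult-onCoordinate i P x y

  onCoordinates : List (Fin t) → List (Biclique G) → List (Biclique (ORPower G t))
  onCoordinates is P = concatMap (λ i → map (onCoordinate i) P) is

  length-onCoordinates : ∀ is P → length (onCoordinates is P) ≡ length is * length P
  length-onCoordinates []       P = refl
  length-onCoordinates (i ∷ is) P = trans (length-++ (map (onCoordinate i) P))
    (cong₂ _+_ (length-map (onCoordinate i) P) (length-onCoordinates is P))

  mult-onCoordinates-∷ : ∀ i is P x y → mult (onCoordinates (i ∷ is) P) x y ≡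
                         mult P (lookup x i) (lookup y i) + mult (onCoordinates is P) x y
  mult-onCoordinates-∷ i is P x y =
    trans (mult-++ (map (onCoordinate i) P) (onCoordinates is P) x y)
          (cong (_+ mult (onCoordinates is P) x y) (mult-onCoordinate i P x y))

  mult-onCoordinates≤ : ∀ {P} → (∀ a b → mult P a b ≤ 1) →
                        ∀ is x y → mult (onCoordinates is P) x y ≤ length is
  mult-onCoordinates≤         mult≤1 []       x y = z≤n
  mult-onCoordinates≤ {P = P} mult≤1 (i ∷ is) x y
    rewrite mult-onCoordinates-∷ i is P x y =
      +-mono-≤ (mult≤1 (lookup x i) (lookup y i)) (mult-onCoordinates≤ mult≤1 is x y)

  mult-onCoordinates≥ : ∀ P {i is} → i ∈ is →
                        ∀ x y → 1 ≤ mult P (lookup x i) (lookup y i) →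
                        1 ≤ mult (onCoordinates is P) x y
  mult-onCoordinates≥ P {is = i ∷ is} (here refl) x y covered
    rewrite mult-onCoordinates-∷ i is P x y = ≤-trans covered (m≤m+n _ _)
  mult-onCoordinates≥ P {is = j ∷ is} (there i∈is) x y covered
    rewrite mult-onCoordinates-∷ j is P x y =
      ≤-trans (mult-onCoordinates≥ P i∈is x y covered) (m≤n+m _ _)

  partition⇒ORPower-covering : (∀ x y → Adj G x y → Adj G y x) →
    ∀ {P} → IsBicliquePartition G P →
    IsTBicliqueCovering t (ORPower G t) (onCoordinates (allFin t) P)
  partition⇒ORPower-covering adj-sym {P} partition x y (i , xᵢ∼yᵢ) =
      mult-onCoordinates≥ P (∈-allFin i) x y (≤-reflexive (sym (partition _ _ xᵢ∼yᵢ)))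
    , subst (mult (onCoordinates (allFin t) P) x y ≤_) (length-tabulate id)
        (mult-onCoordinates≤ (partition⇒mult≤1 adj-sym {P} partition) (allFin t) x y)

  length-onCoordinates-allFin : ∀ P → length (onCoordinates (allFin t) P) ≡ t * length P
  length-onCoordinates-allFin P =
    trans (length-onCoordinates (allFin t) P) (cong (_* length P) (length-tabulate {n = t} id))

⌊≟⌋-sym : ∀ {n} (a b : Fin n) → ⌊ a ≟ b ⌋ ≡ ⌊ b ≟ a ⌋
⌊≟⌋-sym a b = begin
  ⌊ a ≟ b ⌋    ≡⟨ isYes≗does (a ≟ b) ⟩
  does (a ≟ b) ≡⟨ does-⇔ (mk⇔ sym sym) (a ≟ b) (b ≟ a) ⟩
  does (b ≟ a) ≡⟨ isYes≗does (b ≟ a) ⟨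
  ⌊ b ≟ a ⌋    ∎
  where open ≡-Reasoning

ρ-comm : ∀ {n k} (x y : Vec (Fin n) k) → ρ x y ≡ ρ y x
ρ-comm = zipWith-comm (λ a b → cong not (⌊≟⌋-sym a b))

Gn-sym : ∀ n x y → Adj (Gn n) x y → Adj (Gn n) y x
Gn-sym n x y = subst (λ v → T (inS v)) (ρ-comm x y)

claim3p5 : (n t : ℕ) → 1 ≤ t →
    (P : List (Biclique (Gn n))) → IsBicliquePartition (Gn n) P →
    Σ (List (Biclique (ORPower (Gn n) t))) λ C →
      IsTBicliqueCovering t (ORPower (Gn n) t) C × (length C ≤ t * length P)
claim3p5 n t _ P partition =
    onCoordinates (allFin t) P
  , partition⇒ORPower-covering {Gn n} {t} (Gn-sym n) partition
  , ≤-reflexive (length-onCoordinates-allFin {Gn n} {t} P)
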